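{- Let $q$ be a power of $2$ and let $a,b\in\mathbb{N}$ with $q\mid a$, $q\mid b$, and $a/q$ odd. Then the monomial $t^{2q^2}[a,b]$ precedes $[a+q,b]$.
   Context: $\mathbb{N}=\{0,1,2,\dots\}$. Let $g:\mathbb{N}\to\mathbb{N}$ be defined by $g(0)=0$, $g(2n)=4g(n)$, $g(2n+1)=g(2n)+1$. For $a,b\in\mathbb{N}$, $[a,b]$ denotes $t^{1+2g(a)+4g(b)}\in\mathbb{Z}/2[t]$; every $t^k$ with $k$ odd positive is uniquely of this form. Say $[c,d]$ precedes $[a,b]$ if $c+d<a+b$, or $c+d=a+b$ and $d<b$. -}

module Defs where

open import Data.Nat using (ℕ; zero; suc; _+_; _*_; _^_; _<_; NonZero)
open import Data.Nat.DivMod using (_/_; _%_)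
open import Data.Nat.Properties using (m^n≢0)
open import Data.Product using (_×_; ∃)
open import Data.Sum using (_⊎_)
open import Relation.Binary.PropositionalEquality using (_≡_)

-- g with g 0 = 0, g (2n) = 4 g n, g (2n+1) = g (2n) + 1,
-- computed by recursion on binary digits (fuel n suffices: n has ≤ n binary digits).
gFuel : ℕ → ℕ → ℕ
gFuel zero    n = 0
gFuel (suc f) n = 4 * gFuel f (n / 2) + n % 2

g : ℕ → ℕ
g n = gFuel n n

-- exponent k with [a,b] = t^k, i.e. k = 1 + 2 g(a) + 4 g(b)
bracketExp : ℕ → ℕ → ℕ
bracketExp a b = 1 + 2 * g a + 4 * g b

Precedes : ℕ × ℕ → ℕ × ℕ → Set
Precedes (c Data.Product., d) (a Data.Product., b) =
  (c + d < a + b) ⊎ ((c + d ≡ a + b) × (d < b))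

Odd : ℕ → Set
Odd n = ∃ λ m → n ≡ 1 + 2 * m

_/2^_ : ℕ → ℕ → ℕ
a /2^ k = _/_ a (2 ^ k) {{m^n≢0 2 k}}

module Submission where

-- Put q = 2^k, a = q x, b = q y. The exponent of [a,b] is 1 + 2 F(a,b) with
-- F(x,y) = g x + 2 g y, which interleaves the binary digits of x and y, and
-- F(q x, q y) = q² F(x,y) because g(2n) = 4 g(n). So t^{2q²}[a,b] = [q c, q d]
-- where F(c,d) = F(x,y) + 1. For odd x, adding 1 to the interleaved number
-- clears the trailing ones, among them the lowest digit of x, and the one digit
-- it sets is worth no more than those cleared, so c + d ≤ x + y < x + y + 1.

open import Defs
open import Data.Nat using (ℕ; zero; suc; _+_; _*_; _^_; _≤_; _<_; s≤s; z<s; s<s; _/_; _%_; NonZero; >-nonZero⁻¹)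
open import Data.Nat.Properties
open import Data.Nat.DivMod
open import Data.Nat.Divisibility using (_∣_; divides; n∣m*n)
open import Data.Nat.Solver using (module +-*-Solver)
open import Data.Product using (_×_; _,_; ∃₂)
open import Data.Sum using (inj₁)
open import Relation.Binary.PropositionalEquality
open +-*-Solver

gFuel-zero : ∀ f → gFuel f 0 ≡ 0
gFuel-zero zero    = refl
gFuel-zero (suc f) = cong (λ r → 4 * r + 0) (gFuel-zero f)

/2≤pred : ∀ n → suc n / 2 ≤ n
/2≤pred n = ≤-pred (m/n<m (suc n) 2 (s<s z<s))

gFuel-irrelevant : ∀ f f′ n → n ≤ f → n ≤ f′ → gFuel f n ≡ gFuel f′ n
gFuel-irrelevant f f′ zero _ _ = trans (gFuel-zero f) (sym (gFuel-zero f′))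
gFuel-irrelevant (suc f) (suc f′) (suc n) (s≤s n≤f) (s≤s n≤f′) =
  cong (λ r → 4 * r + suc n % 2)
    (gFuel-irrelevant f f′ (suc n / 2) (≤-trans (/2≤pred n) n≤f) (≤-trans (/2≤pred n) n≤f′))

g-unfold : ∀ n → g n ≡ 4 * g (n / 2) + n % 2
g-unfold zero    = refl
g-unfold (suc n) =
  cong (λ r → 4 * r + suc n % 2) (gFuel-irrelevant n (suc n / 2) (suc n / 2) (/2≤pred n) ≤-refl)

g-digit : ∀ i n → i < 2 → g (i + n * 2) ≡ i + 4 * g n
g-digit i n i<2 = begin
  g (i + n * 2)                             ≡⟨ g-unfold (i + n * 2) ⟩
  4 * g ((i + n * 2) / 2) + (i + n * 2) % 2 ≡⟨ cong₂ (λ m r → 4 * g m + r) quotient remainder ⟩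
  4 * g n + i                               ≡⟨ +-comm (4 * g n) i ⟩
  i + 4 * g n                               ∎
  where
  open ≡-Reasoning
  remainder : (i + n * 2) % 2 ≡ i
  remainder = trans ([m+kn]%n≡m%n i n 2) (m<n⇒m%n≡m i<2)
  quotient : (i + n * 2) / 2 ≡ n
  quotient = begin
    (i + n * 2) / 2     ≡⟨ +-distrib-/-∣ʳ i (n∣m*n n) ⟩
    i / 2 + n * 2 / 2   ≡⟨ cong₂ _+_ (m<n⇒m/n≡0 i<2) (m*n/n≡m n 2) ⟩
    n                   ∎

interleave : ℕ → ℕ → ℕ
interleave x y = g x + 2 * g y

interleave-digits : ∀ i j m n → i < 2 → j < 2 →
  interleave (i + m * 2) (j + n * 2) ≡ i + 2 * j + 4 * interleave m n
interleave-digits i j m n i<2 j<2 rewrite g-digit i m i<2 | g-digit j n j<2 =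
  solve 4 (λ i j a b → i :+ con 4 :* a :+ con 2 :* (j :+ con 4 :* b)
                    := i :+ con 2 :* j :+ con 4 :* (a :+ con 2 :* b))
    refl i j (g m) (g n)

-- Recursion on this view, unlike recursion on n / 2, is structural.
data Binary : ℕ → Set where
  zero : Binary 0
  even : ∀ {n} → Binary n → Binary (n * 2)
  odd  : ∀ {n} → Binary n → Binary (1 + n * 2)

binary-suc : ∀ {n} → Binary n → Binary (suc n)
binary-suc zero     = odd zero
binary-suc (even b) = odd b
binary-suc (odd b)  = even (binary-suc b)

binary : ∀ n → Binary n
binary zero    = zero
binary (suc n) = binary-suc (binary n)

SuccessorWithin : ℕ → ℕ → ℕ → Set
SuccessorWithin x y s = ∃₂ λ c d → interleave c d ≡ suc (interleave x y) × c + d ≤ s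

successor-odd-even : ∀ m n → SuccessorWithin (1 + m * 2) (n * 2) (1 + m * 2 + n * 2)
successor-odd-even m n =
  m * 2 , 1 + n * 2 ,
  trans (interleave-digits 0 1 m n z<s (s<s z<s))
        (cong suc (sym (interleave-digits 1 0 m n (s<s z<s) z<s))) ,
  ≤-reflexive (+-suc (m * 2) (n * 2))

mutual
  successor : ∀ {x} → Binary x → ∀ y → SuccessorWithin x y (suc (x + y))
  successor zero y = 1 , y , refl , ≤-refl
  successor (even {m} _) y =
    1 + m * 2 , y ,
    cong (_+ 2 * g y) (trans (g-digit 1 m (s<s z<s)) (cong suc (sym (g-digit 0 m z<s)))) ,
    ≤-refl
  successor (odd b) y with successor-odd b y
  ... | c , d , next , c+d≤ = c , d , next , m≤n⇒m≤1+n c+d≤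

  successor-odd : ∀ {m} → Binary m → ∀ y → SuccessorWithin (1 + m * 2) y (1 + m * 2 + y)
  successor-odd {m} b y with binary y
  ... | zero       = successor-odd-even m 0
  ... | even {n} _ = successor-odd-even m n
  ... | odd {n} _ with successor b n
  ... | c , d , next , c+d≤ = c * 2 , d * 2 , doubled-next , doubled-bound
    where
    doubled-next : interleave (c * 2) (d * 2) ≡ suc (interleave (1 + m * 2) (1 + n * 2))
    doubled-next = begin
      interleave (c * 2) (d * 2)            ≡⟨ interleave-digits 0 0 c d z<s z<s ⟩
      4 * interleave c d                    ≡⟨ cong (4 *_) next ⟩
      4 * suc (interleave m n)              ≡⟨ *-suc 4 (interleave m n) ⟩
      4 + 4 * interleave m n                ≡⟨ cong suc (interleave-digits 1 1 m n (s<s z<s) (s<s z<s)) ⟨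
      suc (interleave (1 + m * 2) (1 + n * 2)) ∎
      where open ≡-Reasoning
    doubled-bound : c * 2 + d * 2 ≤ 1 + m * 2 + (1 + n * 2)
    doubled-bound = begin
      c * 2 + d * 2          ≡⟨ *-distribʳ-+ 2 c d ⟨
      (c + d) * 2            ≤⟨ *-monoˡ-≤ 2 c+d≤ ⟩
      suc (m + n) * 2        ≡⟨ solve 2 (λ m n → (con 1 :+ (m :+ n)) :* con 2
                                                := con 1 :+ m :* con 2 :+ (con 1 :+ n :* con 2)) refl m n ⟩
      1 + m * 2 + (1 + n * 2) ∎
      where open ≤-Reasoning

successor-of-odd : ∀ x y → Odd x → SuccessorWithin x y (x + y)
successor-of-odd .(1 + 2 * m) y (m , refl) =
  subst (λ x → SuccessorWithin x y (x + y)) (cong suc (*-comm m 2)) (successor-odd (binary m) y)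

g-*2^ : ∀ k x → g (x * 2 ^ k) ≡ 2 ^ k * 2 ^ k * g x
g-*2^ zero    x = trans (cong g (*-identityʳ x)) (sym (+-identityʳ (g x)))
g-*2^ (suc k) x = begin
  g (x * (2 * 2 ^ k))           ≡⟨ cong g (trans (cong (x *_) (*-comm 2 (2 ^ k))) (sym (*-assoc x (2 ^ k) 2))) ⟩
  g (x * 2 ^ k * 2)             ≡⟨ g-digit 0 (x * 2 ^ k) z<s ⟩
  4 * g (x * 2 ^ k)             ≡⟨ cong (4 *_) (g-*2^ k x) ⟩
  4 * (2 ^ k * 2 ^ k * g x)     ≡⟨ solve 2 (λ q h → con 4 :* (q :* q :* h) := (con 2 :* q) :* (con 2 :* q) :* h)
                                           refl (2 ^ k) (g x) ⟩
  2 * 2 ^ k * (2 * 2 ^ k) * g x ∎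
  where open ≡-Reasoning

interleave-*2^ : ∀ k x y → interleave (x * 2 ^ k) (y * 2 ^ k) ≡ 2 ^ k * 2 ^ k * interleave x y
interleave-*2^ k x y rewrite g-*2^ k x | g-*2^ k y =
  solve 3 (λ p a b → p :* a :+ con 2 :* (p :* b) := p :* (a :+ con 2 :* b)) refl (2 ^ k * 2 ^ k) (g x) (g y)

bracketExp-interleave : ∀ x y → bracketExp x y ≡ 1 + 2 * interleave x y
bracketExp-interleave x y =
  solve 2 (λ a b → con 1 :+ con 2 :* a :+ con 4 :* b := con 1 :+ con 2 :* (a :+ con 2 :* b)) refl (g x) (g y)

bracketExp-*2^-successor : ∀ k {a b c d} → interleave c d ≡ suc (interleave a b) →
  bracketExp (c * 2 ^ k) (d * 2 ^ k) ≡ 2 * 2 ^ k * 2 ^ k + bracketExp (a * 2 ^ k) (b * 2 ^ k)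
bracketExp-*2^-successor k {a} {b} {c} {d} next = begin
  bracketExp (c * q) (d * q)               ≡⟨ bracketExp-interleave (c * q) (d * q) ⟩
  1 + 2 * interleave (c * q) (d * q)       ≡⟨ cong (λ i → 1 + 2 * i) (interleave-*2^ k c d) ⟩
  1 + 2 * (q * q * interleave c d)         ≡⟨ cong (λ i → 1 + 2 * (q * q * i)) next ⟩
  1 + 2 * (q * q * suc (interleave a b))   ≡⟨ solve 2 (λ q i → con 1 :+ con 2 :* (q :* q :* (con 1 :+ i))
                                                 := con 2 :* q :* q :+ (con 1 :+ con 2 :* (q :* q :* i)))
                                                refl q (interleave a b) ⟩
  2 * q * q + (1 + 2 * (q * q * interleave a b))
    ≡⟨ cong (λ i → 2 * q * q + (1 + 2 * i)) (interleave-*2^ k a b) ⟨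
  2 * q * q + (1 + 2 * interleave (a * q) (b * q))
    ≡⟨ cong (2 * q * q +_) (bracketExp-interleave (a * q) (b * q)) ⟨
  2 * q * q + bracketExp (a * q) (b * q)   ∎
  where
  q = 2 ^ k
  open ≡-Reasoning

precedes-scaled : ∀ {a b c d} q .{{_ : NonZero q}} → c + d ≤ a + b →
  Precedes (c * q , d * q) (a * q + q , b * q)
precedes-scaled {a} {b} {c} {d} q c+d≤ = inj₁ (begin-strict
  c * q + d * q     ≡⟨ *-distribʳ-+ q c d ⟨
  (c + d) * q       ≤⟨ *-monoˡ-≤ q c+d≤ ⟩
  (a + b) * q       <⟨ m<m+n ((a + b) * q) (>-nonZero⁻¹ q) ⟩
  (a + b) * q + q   ≡⟨ solve 3 (λ a b q → (a :+ b) :* q :+ q := a :* q :+ q :+ b :* q) refl a b q ⟩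
  a * q + q + b * q ∎)
  where open ≤-Reasoning

lemma2p5 : (k a b : ℕ) → (2 ^ k) ∣ a → (2 ^ k) ∣ b → Odd (a /2^ k) →
    ∃₂ λ c d → (bracketExp c d ≡ 2 * (2 ^ k) * (2 ^ k) + bracketExp a b)
    × Precedes (c , d) (a + 2 ^ k , b)
lemma2p5 k _ _ (divides a refl) (divides b refl) a-odd =
  let c , d , next , c+d≤ = successor-of-odd a b (subst Odd (m*n/n≡m a (2 ^ k) {{2^k≢0}}) a-odd)
  in  c * 2 ^ k , d * 2 ^ k , bracketExp-*2^-successor k {a} {b} {c} {d} next ,
      precedes-scaled {a} {b} {c} {d} (2 ^ k) {{2^k≢0}} c+d≤
  where
  2^k≢0 : NonZero (2 ^ k)
  2^k≢0 = m^n≢0 2 k
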